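{- Let $\alpha>0$ be an ordinal and $S\subseteq\mathbb{N}^\mathbb{N}$. The following are equivalent: (i) $S$ is guessable with $<\alpha+1$ mind changes; (ii) $S\in D_\alpha$ or $\mathbb{N}^\mathbb{N}\setminus S\in D_\alpha$.
   Context: $\mathbb{N}^\mathbb{N}$ has the Baire space topology (basic open sets: all extensions of a fixed finite sequence). $\mathbb{N}^{<\mathbb{N}}$ is the set of finite sequences; $f\upharpoonright n$ is the length-$n$ initial segment of $f$; $\chi_S$ is the characteristic function of $S$. $G:\mathbb{N}^{<\mathbb{N}}\to\{0,1\}$ is an $S$-guesser if $\lim_nG(f\upharpoonright n)=\chi_S(f)$ for all $f$. For an ordinal $\gamma$, $S$ is guessable with $<\gamma$ mind changes if there are an $S$-guesser $G$ and $H:\mathbb{N}^{<\mathbb{N}}\to\gamma$ such that for all $f,n$: $H(f\upharpoonright(n+1))\le H(f\upharpoonright n)$, and if $G(f\upharpoonright(n+1))\ne G(f\upharpoonright n)$ then $H(f\upharpoonright(n+1))<H(f\upharpoonright n)$. The parity of an ordinal $\eta=\lambda+n$ ($\lambda$ zero or a limit ordinal, $n\in\mathbb{N}$) is $n\bmod 2$. For $\theta\ge1$ and an increasing sequence $(A_\eta)_{\eta<\theta}$ of subsets of $\mathbb{N}^\mathbb{N}$, $x\in D_\theta((A_\eta)_{\eta<\theta})$ iff $x\in\bigcup_{\eta<\theta}A_\eta$ and the least $\eta$ with $x\in A_\eta$ has parity opposite to that of $\theta$. $D_\theta$ is the set of all $D_\theta((A_\eta)_{\eta<\theta})$ with each $A_\eta$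 open. -}

module Defs where

open import Level using (0ℓ)
open import Data.Nat using (ℕ; zero; suc; _≤_; _%_)
open import Data.Bool using (Bool; true; false; not)
open import Data.List using (List; applyUpTo)
open import Data.Maybe using (Maybe; just; nothing)
open import Data.Product using (Σ; ∃; ∃-syntax; _×_; _,_)
open import Data.Sum using (_⊎_)
open import Data.Unit using (⊤)
open import Data.Empty using (⊥)
open import Relation.Nullary using (¬_)
open import Relation.Binary.Core using (Rel)
open import Relation.Binary.Structures using (IsStrictTotalOrder)
open import Relation.Binary.PropositionalEquality using (_≡_; _≢_)
open import Induction.WellFounded using (WellFounded)
open import Function.Bundles using (_⇔_)

Baire : Set
Baire = ℕ → ℕ

FinSeq : Set
FinSeq = List ℕ

_↾_ : Baire → ℕ → FinSeq
f ↾ n = applyUpTo f n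

IsOpen : (Baire → Set) → Set
IsOpen A = ∀ f → A f → ∃[ n ] (∀ g → g ↾ n ≡ f ↾ n → A g)

record Ordinal : Set₁ where
  field
    Carrier            : Set
    _<_                : Rel Carrier 0ℓ
    isStrictTotalOrder : IsStrictTotalOrder _≡_ _<_
    wellFounded        : WellFounded _<_

-- the successor ordinal α+1 = α with a new top element (nothing)
module _ (α : Ordinal) where
  open Ordinal α

  Succ : Set
  Succ = Maybe Carrier

  _<⁺_ : Succ → Succ → Set
  just x  <⁺ just y  = x < y
  just x  <⁺ nothing = ⊤
  nothing <⁺ _       = ⊥

  _≤⁺_ : Succ → Succ → Set
  x ≤⁺ y = x <⁺ y ⊎ x ≡ y

-- Parity of an element of a well-order: η = λ + n with λ zero or a
-- limit (i.e. not a successor), parity = n mod 2.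

module _ {C : Set} (_<_ : C → C → Set) where

  ImmSucc : C → C → Set
  ImmSucc ζ η = ζ < η × (∀ w → ζ < w → ¬ (w < η))

  IsSuccessor : C → Set
  IsSuccessor η = ∃[ ζ ] ImmSucc ζ η

  SuccN : ℕ → C → C → Set
  SuccN zero    λ₀ η = λ₀ ≡ η
  SuccN (suc n) λ₀ η = ∃[ ζ ] (SuccN n λ₀ ζ × ImmSucc ζ η)

  HasParity : C → ℕ → Set
  HasParity η p = ∃[ λ₀ ] ∃[ n ] (¬ IsSuccessor λ₀ × SuccN n λ₀ η × n % 2 ≡ p)

EventuallyGuesses : (FinSeq → Bool) → Baire → Bool → Set
EventuallyGuesses G f b = ∃[ N ] (∀ n → N ≤ n → G (f ↾ n) ≡ b)

IsGuesser : (Baire → Set) → (FinSeq → Bool) → Set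
IsGuesser S G = ∀ f → (S f → EventuallyGuesses G f true)
                    × (¬ S f → EventuallyGuesses G f false)

GuessableWith : (C : Set) → (C → C → Set) → (C → C → Set)
              → (Baire → Set) → Set
GuessableWith C _<_ _≤_ S =
  Σ (FinSeq → Bool) λ G → Σ (FinSeq → C) λ H →
    IsGuesser S G ×
    (∀ f n → H (f ↾ suc n) ≤ H (f ↾ n)) ×
    (∀ f n → G (f ↾ suc n) ≢ G (f ↾ n) → H (f ↾ suc n) < H (f ↾ n))

GuessableLtSucc : Ordinal → (Baire → Set) → Set
GuessableLtSucc α S = GuessableWith (Succ α) (_<⁺_ α) (_≤⁺_ α) S

module _ (θ : Ordinal) where
  open Ordinal θ

  Increasing : (Carrier → Baire → Set) → Set
  Increasing A = ∀ η η' → η < η' → ∀ x → A η x → A η' x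

  -- x ∈ D_θ((A_η)_{η<θ}); parities are computed in θ+1, where θ itself
  -- is the top element 'nothing'
  InDiff : (Carrier → Baire → Set) → Baire → Set
  InDiff A x = ∃[ η ] (A η x × (∀ η' → η' < η → ¬ A η' x) ×
                 ∃[ p ] ∃[ q ] (HasParity (_<⁺_ θ) (just η) p ×
                                HasParity (_<⁺_ θ) nothing q × p ≢ q))

  InD : (Baire → Set) → Set₁
  InD S = ∃[ A ] ((∀ η → IsOpen (A η)) × Increasing A ×
                  (∀ x → S x ⇔ InDiff A x))

-- A guesser G with a mind-change rank H into α + 1 can be normalised (passing to
-- the complement if the first guess is "yes") so that every guess is read off the
-- rank: G s is "yes" exactly when H s has parity opposite to α.  Where they
-- disagree, H s is replaced by its successor, which flips the parity and keeps H
-- descending.  For such a descending H the sets A_η = {x | H (x ↾ n) ≤ η for some n}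
-- are open and increasing, and the least η with x ∈ A_η is the eventual value of
-- H along x, whose parity is the limit of the guesses; so S ∈ D_α.  Conversely,
-- given (A_η) the rank H s = least η with [s] ⊆ A_η (or α if there is none) is
-- descending, generates the same sets, and its parity guesser guesses S.

module Submission where

open import Defs
open import Level using (Level; 0ℓ)
open import Data.Nat using (ℕ; zero; suc; _+_; _≤_; _≤′_; ≤′-refl; ≤′-step; _%_)
open import Data.Nat.Properties using (m≤m+n; m≤n+m; ≤⇒≤′) renaming (_≟_ to _≟ℕ_)
open import Data.Bool using (Bool; true; false; not)
open import Data.Bool.Properties using (¬-not) renaming (_≟_ to _≟𝔹_)
open import Data.List using ([]; length)
open import Data.List.Properties using (length-applyUpTo; applyUpTo-∷ʳ; ∷ʳ-injectiveˡ)
open import Data.Maybe using (just; nothing)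
open import Data.Product using (Σ; ∃; ∃-syntax; _×_; _,_; proj₁; proj₂)
open import Data.Sum using (_⊎_; inj₁; inj₂; [_,_])
import Data.Sum as Sum
open import Data.Unit using (⊤; tt)
open import Function using (_∘_)
open import Function.Bundles using (_⇔_; mk⇔; Equivalence)
open import Function.Construct.Identity using (⇔-id)
open import Function.Construct.Symmetry using (⇔-sym)
open import Function.Construct.Composition using (_⇔-∘_)
open import Induction.WellFounded using (WellFounded; Acc; acc)
open import Axiom.ExcludedMiddle using (ExcludedMiddle)
open import Relation.Nullary using (¬_; Dec; yes; no; does; contradiction)
open import Relation.Nullary.Decidable using (dec-false; does-⇔; decidable-stable; ¬?)
import Relation.Nullary.Decidable as Dec
open import Relation.Unary using (∁)
open import Relation.Binary.Core using (Rel)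
open import Relation.Binary.Definitions
  using (Trichotomous; tri<; tri≈; tri>; Transitive; Irreflexive)
open import Relation.Binary.Structures using (IsStrictTotalOrder)
open import Relation.Binary.Consequences using (tri⇒irr)
open import Relation.Binary.PropositionalEquality
  using (_≡_; _≢_; refl; sym; trans; cong; cong₂; subst)

open Equivalence using (to; from)

%2-suc-≢ : ∀ m n → (suc m % 2 ≢ n % 2) ⇔ (¬ m % 2 ≢ n % 2)
%2-suc-≢ (suc (suc m)) n       = %2-suc-≢ m n
%2-suc-≢ m       (suc (suc n)) = %2-suc-≢ m n
%2-suc-≢ 0 0 = mk⇔ (λ _ 0≢0 → 0≢0 refl) (λ _ ())
%2-suc-≢ 0 1 = mk⇔ (λ 1≢1 → contradiction refl 1≢1) (λ ¬0≢1 → contradiction (λ ()) ¬0≢1)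
%2-suc-≢ 1 0 = mk⇔ (λ 0≢0 → contradiction refl 0≢0) (λ ¬1≢0 → contradiction (λ ()) ¬1≢0)
%2-suc-≢ 1 1 = mk⇔ (λ _ 1≢1 → 1≢1 refl) (λ _ ())

does⇔ : ∀ {P : Set} (P? : Dec P) → does P? ≡ true ⇔ P
does⇔ (yes p) = mk⇔ (λ _ → p) (λ _ → refl)
does⇔ (no ¬p) = mk⇔ (λ ()) (λ p → contradiction p ¬p)

minimal : ExcludedMiddle 0ℓ → {C : Set} {_<_ : Rel C 0ℓ} → WellFounded _<_ →
          (P : C → Set) → ∀ {x} → P x → ∃[ v ] (P v × (∀ w → P w → ¬ w < v))
minimal lem {C} {_<_} wf P {x} = go x (wf x)
  where
  go : ∀ x → Acc _<_ x → P x → ∃[ v ] (P v × (∀ w → P w → ¬ w < v))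
  go x (acc below) px with lem {P = ∃[ w ] (P w × w < x)}
  ... | yes (w , pw , w<x) = go w (below w<x) pw
  ... | no ¬smaller        = x , px , λ w pw w<x → ¬smaller (w , pw , w<x)

module _ {C : Set} {_<_ : Rel C 0ℓ} (compare : Trichotomous _≡_ _<_) where

  immSucc-unique : ∀ {ζ ζ′ η} → ImmSucc _<_ ζ η → ImmSucc _<_ ζ′ η → ζ ≡ ζ′
  immSucc-unique {ζ} {ζ′} (ζ<η , ζ-max) (ζ′<η , ζ′-max) with compare ζ ζ′
  ... | tri< ζ<ζ′ _ _ = contradiction ζ′<η (ζ-max ζ′ ζ<ζ′)
  ... | tri≈ _ ζ≡ζ′ _ = ζ≡ζ′
  ... | tri> _ _ ζ′<ζ = contradiction ζ<η (ζ′-max ζ ζ′<ζ)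

  immSucc-least : ∀ {ζ η θ} → ImmSucc _<_ ζ η → ζ < θ → (η < θ) ⊎ (η ≡ θ)
  immSucc-least {η = η} {θ} (_ , ζ-max) ζ<θ with compare η θ
  ... | tri< η<θ _ _ = inj₁ η<θ
  ... | tri≈ _ η≡θ _ = inj₂ η≡θ
  ... | tri> _ _ θ<η = contradiction θ<η (ζ-max θ ζ<θ)

  succN-unique : ∀ {λ₀ λ₁ η n k} →
                 ¬ IsSuccessor _<_ λ₀ → SuccN _<_ n λ₀ η →
                 ¬ IsSuccessor _<_ λ₁ → SuccN _<_ k λ₁ η → n ≡ k
  succN-unique {n = zero}  {zero}  _ _ _ _ = refl
  succN-unique {n = zero}  {suc k} lim₀ refl _ (ζ , _ , ζ⋖η) = contradiction (ζ , ζ⋖η) lim₀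
  succN-unique {n = suc n} {zero}  _ (ζ , _ , ζ⋖η) lim₁ refl = contradiction (ζ , ζ⋖η) lim₁
  succN-unique {n = suc n} {suc k} lim₀ (ζ , sn , ζ⋖η) lim₁ (ζ′ , sk , ζ′⋖η)
    with immSucc-unique ζ⋖η ζ′⋖η
  ... | refl = cong suc (succN-unique lim₀ sn lim₁ sk)

-- Parity in a well-order

DifferentParity : {C : Set} → (C → C → Set) → C → C → Set
DifferentParity _<_ η θ =
  ∃[ p ] ∃[ q ] (HasParity _<_ η p × HasParity _<_ θ q × p ≢ q)

module Parity (lem : ExcludedMiddle 0ℓ) {C : Set} {_<_ : Rel C 0ℓ}
              (compare : Trichotomous _≡_ _<_) (wf : WellFounded _<_) where

  private
    Decomposition : C → ℕ → Set
    Decomposition η n = ∃[ λ₀ ] (¬ IsSuccessor _<_ λ₀ × SuccN _<_ n λ₀ η)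

    decompose : ∀ η → ∃ (Decomposition η)
    decompose η = go η (wf η)
      where
      go : ∀ η → Acc _<_ η → ∃ (Decomposition η)
      go η (acc below) with lem {P = IsSuccessor _<_ η}
      ... | no lim = 0 , η , lim , refl
      ... | yes (ζ , ζ⋖η) with go ζ (below (proj₁ ζ⋖η))
      ...   | n , λ₀ , lim , sn = suc n , λ₀ , lim , (ζ , sn , ζ⋖η)

    finitePart : C → ℕ
    finitePart η = proj₁ (decompose η)

    decomposition-finitePart : ∀ {η n} → Decomposition η n → n ≡ finitePart η
    decomposition-finitePart {η} (_ , lim , sn) with decompose η
    ... | _ , _ , lim′ , sn′ = succN-unique compare lim sn lim′ sn′

    finitePart-immSucc : ∀ {ζ η} → ImmSucc _<_ ζ η → finitePart η ≡ suc (finitePart ζ)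
    finitePart-immSucc {ζ} ζ⋖η with decompose ζ
    ... | n , λ₀ , lim , sn = sym (decomposition-finitePart (λ₀ , lim , (ζ , sn , ζ⋖η)))

    differentParity⇔ : ∀ {η θ} → DifferentParity _<_ η θ ⇔ (finitePart η % 2 ≢ finitePart θ % 2)
    differentParity⇔ {η} {θ} = mk⇔ to′ from′
      where
      parity≡ : ∀ {ζ p} → HasParity _<_ ζ p → p ≡ finitePart ζ % 2
      parity≡ (λ₀ , n , lim , sn , refl) = cong (_% 2) (decomposition-finitePart (λ₀ , lim , sn))
      to′ : DifferentParity _<_ η θ → finitePart η % 2 ≢ finitePart θ % 2
      to′ (p , q , η∶p , θ∶q , p≢q) e = p≢q (trans (parity≡ η∶p) (trans e (sym (parity≡ θ∶q))))
      hasParity : ∀ ζ → HasParity _<_ ζ (finitePart ζ % 2)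
      hasParity ζ with decompose ζ
      ... | n , λ₀ , lim , sn = λ₀ , n , lim , sn , refl
      from′ : finitePart η % 2 ≢ finitePart θ % 2 → DifferentParity _<_ η θ
      from′ ne = _ , _ , hasParity η , hasParity θ , ne

  differentParity? : ∀ η θ → Dec (DifferentParity _<_ η θ)
  differentParity? η θ =
    Dec.map (⇔-sym differentParity⇔) (¬? (finitePart η % 2 ≟ℕ finitePart θ % 2))

  differentParity-irrefl : ∀ {η} → ¬ DifferentParity _<_ η η
  differentParity-irrefl d = to differentParity⇔ d refl

  differentParity-immSucc : ∀ {ζ η θ} → ImmSucc _<_ ζ η →
                            DifferentParity _<_ η θ ⇔ (¬ DifferentParity _<_ ζ θ)
  differentParity-immSucc {ζ} {η} {θ} ζ⋖η = mk⇔
    (λ dη dζ → to flip (to differentParity⇔ dη) (to differentParity⇔ dζ))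
    (λ ¬dζ → from differentParity⇔ (from flip (¬dζ ∘ from differentParity⇔)))
    where
    flip : (finitePart η % 2 ≢ finitePart θ % 2) ⇔ (¬ finitePart ζ % 2 ≢ finitePart θ % 2)
    flip rewrite finitePart-immSucc ζ⋖η = %2-suc-≢ (finitePart ζ) (finitePart θ)

-- The well-order α + 1

module SuccOrder (α : Ordinal) where
  open Ordinal α
  module < = IsStrictTotalOrder isStrictTotalOrder

  infix 4 _⊏_ _⊑_

  _⊏_ : Rel (Succ α) 0ℓ
  _⊏_ = _<⁺_ α

  _⊑_ : Rel (Succ α) 0ℓ
  _⊑_ = _≤⁺_ α

  ⊏-compare : Trichotomous _≡_ _⊏_
  ⊏-compare (just x) (just y) with <.compare x y
  ... | tri< x<y x≢y y≮x = tri< x<y (λ { refl → x≢y refl }) y≮x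
  ... | tri≈ x≮y refl y≮x = tri≈ x≮y refl y≮x
  ... | tri> x≮y x≢y y<x = tri> x≮y (λ { refl → x≢y refl }) y<x
  ⊏-compare (just x) nothing  = tri< tt (λ ()) (λ ())
  ⊏-compare nothing  (just y) = tri> (λ ()) (λ ()) tt
  ⊏-compare nothing  nothing  = tri≈ (λ ()) refl (λ ())

  ⊏-irrefl : Irreflexive _≡_ _⊏_
  ⊏-irrefl = tri⇒irr ⊏-compare

  ⊏-trans : Transitive _⊏_
  ⊏-trans {just x} {just y} {just z} x<y y<z = <.trans x<y y<z
  ⊏-trans {just x} {just y} {nothing} _ _    = tt
  ⊏-trans {just x} {nothing} {just z} _ ()
  ⊏-trans {just x} {nothing} {nothing} _ ()

  ⊏-wellFounded : WellFounded _⊏_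
  ⊏-wellFounded (just x) = acc-just (wellFounded x)
    where
    acc-just : ∀ {x} → Acc _<_ x → Acc _⊏_ (just x)
    acc-just (acc below) = acc λ { {just y} y<x → acc-just (below y<x) }
  ⊏-wellFounded nothing = acc λ { {just y} _ → ⊏-wellFounded (just y) }

  ⊑-⊏-trans : ∀ {x y z} → x ⊑ y → y ⊏ z → x ⊏ z
  ⊑-⊏-trans {x} {y} {z} (inj₁ x<y) y<z = ⊏-trans {x} {y} {z} x<y y<z
  ⊑-⊏-trans             (inj₂ refl) y<z = y<z

  ⊑-trans : ∀ {x y z} → x ⊑ y → y ⊑ z → x ⊑ z
  ⊑-trans x⊑y (inj₁ y<z) = inj₁ (⊑-⊏-trans x⊑y y<z)
  ⊑-trans x⊑y (inj₂ refl) = x⊑y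

  ⊑-antisym : ∀ {x y} → x ⊑ y → y ⊑ x → x ≡ y
  ⊑-antisym {x} x⊑y (inj₁ y<x) = contradiction (⊑-⊏-trans x⊑y y<x) (⊏-irrefl {x} refl)
  ⊑-antisym _ (inj₂ y≡x) = sym y≡x

  ≮⇒⊒ : ∀ {x y} → ¬ x ⊏ y → y ⊑ x
  ≮⇒⊒ {x} {y} x≮y with ⊏-compare x y
  ... | tri< x<y _ _ = contradiction x<y x≮y
  ... | tri≈ _ x≡y _ = inj₂ (sym x≡y)
  ... | tri> _ _ y<x = inj₁ y<x

  nothing⊑⇒≡ : ∀ {x} → nothing ⊑ x → x ≡ nothing
  nothing⊑⇒≡ (inj₂ refl) = refl

↾-suc-prefix : ∀ f g n → g ↾ suc n ≡ f ↾ suc n → g ↾ n ≡ f ↾ n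
↾-suc-prefix f g n e =
  ∷ʳ-injectiveˡ (g ↾ n) (f ↾ n) (trans (applyUpTo-∷ʳ g n) (trans e (sym (applyUpTo-∷ʳ f n))))

↾-extends : ∀ f g n → (g ↾ length (f ↾ n) ≡ f ↾ n) ⇔ (g ↾ n ≡ f ↾ n)
↾-extends f g n rewrite length-applyUpTo f n = ⇔-id _

GuessesAt : (Baire → Set) → (FinSeq → Bool) → Baire → Set
GuessesAt S G f = (S f → EventuallyGuesses G f true) × (¬ S f → EventuallyGuesses G f false)

isGuesser-resp : ∀ {S G G′} → (∀ f n → G (f ↾ n) ≡ G′ (f ↾ n)) → IsGuesser S G → IsGuesser S G′
isGuesser-resp {G = G} {G′} G≗G′ guesses f =
  transfer ∘ proj₁ (guesses f) , transfer ∘ proj₂ (guesses f)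
  where
  transfer : ∀ {b} → EventuallyGuesses G f b → EventuallyGuesses G′ f b
  transfer (N , ev) = N , λ n N≤n → trans (sym (G≗G′ f n)) (ev n N≤n)

not-eventually : ∀ G {f b} → EventuallyGuesses G f b → EventuallyGuesses (not ∘ G) f (not b)
not-eventually G (N , ev) = N , λ n N≤n → cong not (ev n N≤n)

∁-guesser : ExcludedMiddle 0ℓ → ∀ {S} G → IsGuesser S G → IsGuesser (∁ S) (not ∘ G)
∁-guesser lem G guesses f =
  not-eventually G ∘ proj₂ (guesses f) ,
  not-eventually G ∘ proj₁ (guesses f) ∘ decidable-stable lem

∁-guesser⁻¹ : ∀ {S} G → IsGuesser (∁ S) G → IsGuesser S (not ∘ G)
∁-guesser⁻¹ G guesses f =
  (λ s → not-eventually G (proj₂ (guesses f) (λ ¬s → ¬s s))) ,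
  not-eventually G ∘ proj₁ (guesses f)

guessesAt⇔ : ExcludedMiddle 0ℓ → ∀ {S G f m b} → (∀ n → m ≤ n → G (f ↾ n) ≡ b) →
             GuessesAt S G f ⇔ (S f ⇔ b ≡ true)
guessesAt⇔ lem {S} {G} {f} {m} {b} constant = mk⇔ to′ from′
  where
  limit : ∀ {c} → EventuallyGuesses G f c → b ≡ c
  limit (N , ev) = trans (sym (constant (N + m) (m≤n+m m N))) (ev (N + m) (m≤m+n N m))
  to′ : GuessesAt S G f → S f ⇔ b ≡ true
  to′ (onS , off) = mk⇔ (limit ∘ onS) λ b≡true →
    decidable-stable lem λ ¬s → contradiction (trans (sym b≡true) (limit (off ¬s))) λ ()
  from′ : (S f ⇔ b ≡ true) → GuessesAt S G f
  from′ S⇔b = (λ s → m , λ n m≤n → trans (constant n m≤n) (to S⇔b s)) ,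
              (λ ¬s → m , λ n m≤n → trans (constant n m≤n) (¬-not (¬s ∘ from S⇔b)))

guessable-not : ∀ α {S S′} → (∀ G → IsGuesser S G → IsGuesser S′ (not ∘ G)) →
                GuessableLtSucc α S → GuessableLtSucc α S′
guessable-not α negate (G , H , guesses , descends , drops) =
  not ∘ G , H , negate G guesses , descends ,
  λ f n changed → drops f n (λ same → changed (cong not same))

-- Guessing by the parity of a descending rank

module Guessing (lem : ExcludedMiddle 0ℓ) (α : Ordinal) where
  open Ordinal α using (Carrier)
  open SuccOrder α
  open Parity lem ⊏-compare ⊏-wellFounded

  oppositeParity : Succ α → Bool
  oppositeParity x = does (differentParity? x nothing)

  oppositeParity-true : ∀ {x} → oppositeParity x ≡ true ⇔ DifferentParity _⊏_ x nothing
  oppositeParity-true {x} = does⇔ (differentParity? x nothing)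

  oppositeParity-top : oppositeParity nothing ≡ false
  oppositeParity-top = dec-false (differentParity? nothing nothing) differentParity-irrefl

  oppositeParity-immSucc : ∀ {x y} → ImmSucc _⊏_ x y → oppositeParity y ≡ not (oppositeParity x)
  oppositeParity-immSucc {x} {y} x⋖y =
    does-⇔ (differentParity-immSucc x⋖y)
           (differentParity? y nothing) (¬? (differentParity? x nothing))

  next : Succ α → Succ α
  next (just z) = proj₁ (minimal lem ⊏-wellFounded (just z ⊏_) {nothing} tt)
  next nothing  = nothing

  next-immSucc : ∀ z → ImmSucc _⊏_ (just z) (next (just z))
  next-immSucc z = proj₂ (minimal lem ⊏-wellFounded (just z ⊏_) {nothing} tt)

  ⊑-next : ∀ x → x ⊑ next x
  ⊑-next (just z) = inj₁ (proj₁ (next-immSucc z))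
  ⊑-next nothing  = inj₂ refl

  next-least : ∀ {x y} → x ⊏ y → next x ⊑ y
  next-least {just z} {y} z<y =
    immSucc-least ⊏-compare {just z} {next (just z)} {y} (next-immSucc z) z<y

  adjust : Bool → Succ α → Succ α
  adjust b x with b ≟𝔹 oppositeParity x
  ... | yes _ = x
  ... | no _  = next x

  adjust-bounds : ∀ b x → x ⊑ adjust b x × adjust b x ⊑ next x
  adjust-bounds b x with b ≟𝔹 oppositeParity x
  ... | yes _ = inj₂ refl , ⊑-next x
  ... | no _  = ⊑-next x , inj₂ refl

  oppositeParity-adjust : ∀ b x → (x ≡ nothing → b ≡ false) → oppositeParity (adjust b x) ≡ b
  oppositeParity-adjust b x top with b ≟𝔹 oppositeParity x
  oppositeParity-adjust b x        _   | yes b≡ = sym b≡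
  oppositeParity-adjust b (just z) _   | no b≢  =
    trans (oppositeParity-immSucc {just z} (next-immSucc z)) (sym (¬-not b≢))
  oppositeParity-adjust b nothing  top | no b≢  =
    contradiction (trans (top refl) (sym oppositeParity-top)) b≢

  Descending : (FinSeq → Succ α) → Set
  Descending H = ∀ f n → H (f ↾ suc n) ⊑ H (f ↾ n)

  inDiff⇔ : ∀ {A x} v → (∀ η → A η x ⇔ v ⊑ just η) → InDiff α A x ⇔ oppositeParity v ≡ true
  inDiff⇔ nothing A⇔ =
    mk⇔ (λ (η , a , _) → contradiction (nothing⊑⇒≡ (to (A⇔ η) a)) λ ())
        (λ e → contradiction (trans (sym e) oppositeParity-top) λ ())
  inDiff⇔ {A} {x} (just ζ) A⇔ = mk⇔ to′ from′
    where
    to′ : InDiff α A x → oppositeParity (just ζ) ≡ true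
    to′ (η , a , least , different) with to (A⇔ η) a
    ... | inj₁ ζ<η = contradiction (from (A⇔ ζ) (inj₂ refl)) (least ζ ζ<η)
    ... | inj₂ refl = from oppositeParity-true different
    from′ : oppositeParity (just ζ) ≡ true → InDiff α A x
    from′ e = ζ , from (A⇔ ζ) (inj₂ refl) ,
              (λ η η<ζ a → ⊏-irrefl refl (⊑-⊏-trans (to (A⇔ η) a) η<ζ)) ,
              to oppositeParity-true e

  RankGuessable : (Baire → Set) → Set
  RankGuessable S = Σ (FinSeq → Succ α) λ H → Descending H × IsGuesser S (oppositeParity ∘ H)

  Generates : (FinSeq → Succ α) → (Carrier → Baire → Set) → Set
  Generates H A = ∀ η x → A η x ⇔ (∃[ n ] H (x ↾ n) ⊑ just η)

  module DescendingRank (H : FinSeq → Succ α) (descends : Descending H) where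

    descending-⊑ : ∀ {f m n} → m ≤′ n → H (f ↾ n) ⊑ H (f ↾ m)
    descending-⊑ ≤′-refl = inj₂ refl
    descending-⊑ {f} (≤′-step {n} m≤′n) = ⊑-trans (descends f n) (descending-⊑ m≤′n)

    record LimitStage (f : Baire) : Set where
      field
        stage : ℕ
        least : ∀ n → H (f ↾ stage) ⊑ H (f ↾ n)

      limit : Succ α
      limit = H (f ↾ stage)

    open LimitStage

    limitStage : ∀ f → LimitStage f
    limitStage f with minimal lem ⊏-wellFounded (λ v → ∃[ n ] H (f ↾ n) ≡ v) (0 , refl)
    ... | _ , (m , refl) , below = record
      { stage = m ; least = λ n → ≮⇒⊒ (below (H (f ↾ n)) (n , refl)) }

    limit-stable : ∀ {f n} (l : LimitStage f) → stage l ≤ n → H (f ↾ n) ≡ limit l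
    limit-stable {f} l m≤n = ⊑-antisym (descending-⊑ {f} (≤⇒≤′ m≤n)) (least l _)

    limit-⊑⇔ : ∀ {f y} (l : LimitStage f) → (∃[ n ] H (f ↾ n) ⊑ y) ⇔ limit l ⊑ y
    limit-⊑⇔ l = mk⇔ (λ (n , Hn⊑y) → ⊑-trans (least l n) Hn⊑y) (λ l⊑y → stage l , l⊑y)

    guesser⇔inDiff : ∀ {S A} → Generates H A →
                     IsGuesser S (oppositeParity ∘ H) ⇔ (∀ x → S x ⇔ InDiff α A x)
    guesser⇔inDiff {S} {A} generates =
      mk⇔ (λ guesses x → to (pointwise x) (guesses x)) (λ S⇔ x → from (pointwise x) (S⇔ x))
      where
      pointwise : ∀ x → GuessesAt S (oppositeParity ∘ H) x ⇔ (S x ⇔ InDiff α A x)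
      pointwise x = mk⇔ (λ g → ⇔-sym inDiff ⇔-∘ to guess g) (λ S⇔ → from guess (inDiff ⇔-∘ S⇔))
        where
        l : LimitStage x
        l = limitStage x
        inDiff : InDiff α A x ⇔ oppositeParity (limit l) ≡ true
        inDiff = inDiff⇔ {A} {x} (limit l) λ η → limit-⊑⇔ l ⇔-∘ generates η x
        guess : GuessesAt S (oppositeParity ∘ H) x ⇔ (S x ⇔ oppositeParity (limit l) ≡ true)
        guess = guessesAt⇔ lem {S} {oppositeParity ∘ H} {x} λ n m≤n →
                  cong oppositeParity (limit-stable l m≤n)

  rankGuessable⇒InD : ∀ {S} → RankGuessable S → InD α S
  rankGuessable⇒InD (H , descends , guesses) =
    A , A-open , A-increasing , to (guesser⇔inDiff (λ _ _ → ⇔-id _)) guesses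
    where
    open DescendingRank H descends
    A : Carrier → Baire → Set
    A η x = ∃[ n ] H (x ↾ n) ⊑ just η
    A-open : ∀ η → IsOpen (A η)
    A-open η x (n , le) = n , λ g g≡x → n , subst (λ s → H s ⊑ just η) (sym g≡x) le
    A-increasing : Increasing α A
    A-increasing η η′ η<η′ x (n , le) = n , inj₁ (⊑-⊏-trans le η<η′)

  rankGuessable⇒guessable : ∀ {S} → RankGuessable S → GuessableLtSucc α S
  rankGuessable⇒guessable (H , descends , guesses) =
    oppositeParity ∘ H , H , guesses , descends , drops
    where
    drops : ∀ f n → oppositeParity (H (f ↾ suc n)) ≢ oppositeParity (H (f ↾ n)) →
            H (f ↾ suc n) ⊏ H (f ↾ n)
    drops f n changed with descends f n
    ... | inj₁ dropped = dropped
    ... | inj₂ same    = contradiction (cong oppositeParity same) changed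

  module CoverRank {A : Carrier → Baire → Set}
                   (A-open : ∀ η → IsOpen (A η)) (increasing : Increasing α A) where

    Covered : FinSeq → Succ α → Set
    Covered s nothing  = ⊤
    Covered s (just η) = ∀ g → g ↾ length s ≡ s → A η g

    coverRank : FinSeq → Succ α
    coverRank s = proj₁ (minimal lem ⊏-wellFounded (Covered s) {nothing} tt)

    coverRank-covered : ∀ s → Covered s (coverRank s)
    coverRank-covered s = proj₁ (proj₂ (minimal lem ⊏-wellFounded (Covered s) {nothing} tt))

    coverRank-least : ∀ {s} v → Covered s v → coverRank s ⊑ v
    coverRank-least {s} v c =
      ≮⇒⊒ (proj₂ (proj₂ (minimal lem ⊏-wellFounded (Covered s) {nothing} tt)) v c)

    covered-suc : ∀ {f n} v → Covered (f ↾ n) v → Covered (f ↾ suc n) v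
    covered-suc nothing  _ = tt
    covered-suc {f} {n} (just η) c g extends =
      c g (from (↾-extends f g n) (↾-suc-prefix f g n (to (↾-extends f g (suc n)) extends)))

    covered⇒∈ : ∀ {x n η} v → Covered (x ↾ n) v → v ⊑ just η → A η x
    covered⇒∈ nothing _ nothing⊑ = contradiction (nothing⊑⇒≡ nothing⊑) λ ()
    covered⇒∈ {x} {n} (just η′) c η′⊑η with c x (from (↾-extends x x n) refl) | η′⊑η
    ... | x∈Aη′ | inj₁ η′<η = increasing η′ _ η′<η x x∈Aη′
    ... | x∈Aη′ | inj₂ refl = x∈Aη′

    coverRank-descending : Descending coverRank
    coverRank-descending f n = coverRank-least _ (covered-suc _ (coverRank-covered (f ↾ n)))

    coverRank-generates : Generates coverRank A
    coverRank-generates η x =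
      mk⇔ to′ (λ (n , r⊑η) → covered⇒∈ _ (coverRank-covered (x ↾ n)) r⊑η)
      where
      to′ : A η x → ∃[ n ] coverRank (x ↾ n) ⊑ just η
      to′ a with A-open η x a
      ... | n , nbhd = n , coverRank-least (just η) (λ g → nbhd g ∘ to (↾-extends x g n))

  InD⇒rankGuessable : ∀ {S} → InD α S → RankGuessable S
  InD⇒rankGuessable (A , A-open , increasing , S⇔) =
    coverRank , coverRank-descending , from (guesser⇔inDiff coverRank-generates) S⇔
    where
    open CoverRank A-open increasing
    open DescendingRank coverRank coverRank-descending

  module Adjustment (G : FinSeq → Bool) (H : FinSeq → Succ α) (descends : Descending H)
           (drops : ∀ f n → G (f ↾ suc n) ≢ G (f ↾ n) → H (f ↾ suc n) ⊏ H (f ↾ n)) where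

    guess-constant : ∀ f n → H (f ↾ suc n) ≡ H (f ↾ n) → G (f ↾ suc n) ≡ G (f ↾ n)
    guess-constant f n same =
      decidable-stable (G (f ↾ suc n) ≟𝔹 G (f ↾ n)) λ changed → ⊏-irrefl same (drops f n changed)

    guess-top : G [] ≡ false → ∀ f n → H (f ↾ n) ≡ nothing → G (f ↾ n) ≡ false
    guess-top G[] f zero    _   = G[]
    guess-top G[] f (suc n) top =
      trans (guess-constant f n (trans top (sym top′))) (guess-top G[] f n top′)
      where
      top′ : H (f ↾ n) ≡ nothing
      top′ = nothing⊑⇒≡ (subst (_⊑ H (f ↾ n)) top (descends f n))

    adjustRank : FinSeq → Succ α
    adjustRank s = adjust (G s) (H s)

    adjustRank-descending : Descending adjustRank
    adjustRank-descending f n with descends f n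
    ... | inj₁ dropped =
      ⊑-trans (proj₂ (adjust-bounds (G (f ↾ suc n)) (H (f ↾ suc n))))
              (⊑-trans (next-least {H (f ↾ suc n)} dropped)
                       (proj₁ (adjust-bounds (G (f ↾ n)) (H (f ↾ n)))))
    ... | inj₂ same    = inj₂ (cong₂ adjust (guess-constant f n same) same)

    adjustRank-guesses : G [] ≡ false → ∀ f n → G (f ↾ n) ≡ oppositeParity (adjustRank (f ↾ n))
    adjustRank-guesses G[] f n =
      sym (oppositeParity-adjust (G (f ↾ n)) (H (f ↾ n)) (guess-top G[] f n))

  normalise : ∀ {S} (g : GuessableLtSucc α S) → proj₁ g [] ≡ false → RankGuessable S
  normalise (G , H , guesses , descends , drops) G[] =
    adjustRank , adjustRank-descending ,
    isGuesser-resp {G = G} {oppositeParity ∘ adjustRank} (adjustRank-guesses G[]) guesses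
    where open Adjustment G H descends drops

  guessable⇒rankGuessable : ∀ {S} → GuessableLtSucc α S → RankGuessable S ⊎ RankGuessable (∁ S)
  guessable⇒rankGuessable g@(G , _) with G [] in G[]
  ... | false = inj₁ (normalise g G[])
  ... | true  = inj₂ (normalise (guessable-not α (∁-guesser lem) g) (cong not G[]))

theorem4p2 : (lem : ∀ {ℓ : Level} → ExcludedMiddle ℓ)
    → (α : Ordinal) → Ordinal.Carrier α
    → (S : Baire → Set)
    → GuessableLtSucc α S ⇔ (InD α S ⊎ InD α (λ x → ¬ S x))
theorem4p2 lem α _ S = mk⇔
  (Sum.map rankGuessable⇒InD rankGuessable⇒InD ∘ guessable⇒rankGuessable)
  [ rankGuessable⇒guessable ∘ InD⇒rankGuessable
  , guessable-not α ∁-guesser⁻¹ ∘ rankGuessable⇒guessable ∘ InD⇒rankGuessable ]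
  where open Guessing lem α
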